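{- Let $G=(V,E)$ be a finite simple undirected graph, $T \subseteq V$, and $u,v \in T$ with $uv \in E$. Let $G'$ be the graph obtained from $G$ by contracting the edge $uv$ into $v$. Then there is a one-to-one correspondence between the minimal $T$-connecting sets in $G$ and the minimal $(T\setminus\{u\})$-connecting sets in $G'$.
   Context: For a set $T$ of vertices of a graph, a set $S \supseteq T$ is $T$-connecting if the induced subgraph on $S$ is connected, and it is minimal $T$-connecting if no strict subset of $S$ is $T$-connecting. Contracting an edge $uv$ into $v$ means: for every vertex $w \in N(u)\setminus N[v]$ add the edge $vw$, and then delete $u$ together with all edges incident to $u$. -}

module Defs where

open import Data.Nat using (ℕ; suc)
open import Data.Fin using (Fin; punchIn)
open import Data.Fin.Properties using (_≟_)
open import Data.Fin.Subset using (Subset; _∈_; _⊆_; _⊂_)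
open import Data.Bool using (Bool; true; false; _∧_; _∨_; not)
open import Data.Vec using (tabulate; lookup)
open import Data.Product using (_×_)
open import Relation.Nullary using (¬_)
open import Relation.Nullary.Decidable using (⌊_⌋)
open import Relation.Binary.PropositionalEquality using (_≡_; _≢_)

Graph : ℕ → Set
Graph n = Fin n → Fin n → Bool

IsSimple : ∀ {n} → Graph n → Set
IsSimple {n} G = (∀ (x y : Fin n) → G x y ≡ G y x) × (∀ (x : Fin n) → G x x ≡ false)

data Reach {n} (G : Graph n) (S : Subset n) : Fin n → Fin n → Set where
  here : ∀ {x} → x ∈ S → Reach G S x x
  step : ∀ {x y z} → x ∈ S → G x y ≡ true → Reach G S y z → Reach G S x z

Connected : ∀ {n} → Graph n → Subset n → Set
Connected G S = ∀ x y → x ∈ S → y ∈ S → Reach G S x y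

TConnecting : ∀ {n} → Graph n → Subset n → Subset n → Set
TConnecting G T S = T ⊆ S × Connected G S

MinTConnecting : ∀ {n} → Graph n → Subset n → Subset n → Set
MinTConnecting G T S = TConnecting G T S × (∀ S' → S' ⊂ S → ¬ TConnecting G T S')

-- The vertex set V ∖ {u} of the result is
-- identified with Fin n via  punchIn u : Fin n → Fin (suc n)  (an order-preserving
-- bijection onto Fin (suc n) ∖ {u}).  Two remaining vertices a, b are adjacent
-- iff they were adjacent in G, or the edge vw was added for w ∈ N(u) ∖ N[v].
contract : ∀ {n} → Graph (suc n) → (u v : Fin (suc n)) → Graph n
contract G u v i j = G a b ∨ (added a b ∨ added b a)
  where
  a = punchIn u i
  b = punchIn u j
  added : Fin _ → Fin _ → Bool
  added x w = ⌊ x ≟ v ⌋ ∧ (G u w ∧ (not ⌊ w ≟ v ⌋ ∧ not (G v w)))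

removeVertex : ∀ {n} → Subset (suc n) → Fin (suc n) → Subset n
removeVertex T u = tabulate (λ i → lookup T (punchIn u i))

-- Walks in G inside S ∪ {u} and walks in the contraction inside S translate into each other:
-- an edge created by the contraction is a path of length two through u, and conversely a walk
-- of G that enters u from a vertex x ≠ v can jump straight to v, because either xv is an edge
-- of G or it is one of the edges added by the contraction. Hence, whenever u, v ∈ T, the maps
-- S ↦ S ∖ {u} and S' ↦ S' ∪ {u} are mutually inverse, strictly monotone bijections between the
-- T-connecting sets of G containing u and the (T ∖ {u})-connecting sets of the contraction,
-- so they also match up the minimal ones.
module Submission where

open import Defs
open import Data.Nat using (ℕ; suc)
open import Data.Fin using (Fin; punchIn; punchOut)
open import Data.Fin.Properties using (_≟_; punchIn-punchOut; punchIn-injective)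
open import Data.Fin.Subset using (Subset; _∈_; _⊆_; _⊂_)
open import Data.Fin.Subset.Properties using (⊆-antisym)
open import Data.Bool using (Bool; true; false; _∧_; _∨_; not)
open import Data.Bool.Properties using (∨-comm)
open import Data.Vec using (tabulate; lookup; insertAt)
open import Data.Vec.Properties
  using (lookup∘tabulate; tabulate∘lookup; tabulate-cong; insertAt-lookup; insertAt-punchIn; []=⇒lookup; lookup⇒[]=)
open import Data.Product using (Σ; _×_; ∃; _,_; proj₁)
open import Data.Sum using (_⊎_; inj₁; inj₂)
open import Function using (_∘_)
open import Relation.Nullary using (¬_; yes; no; contradiction)
open import Relation.Nullary.Decidable using (⌊_⌋)
open import Relation.Binary.PropositionalEquality

∨-true⁻ : ∀ a {b} → a ∨ b ≡ true → a ≡ true ⊎ b ≡ true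
∨-true⁻ true  _ = inj₁ refl
∨-true⁻ false p = inj₂ p

∨-trueˡ : ∀ {a} b → a ≡ true → a ∨ b ≡ true
∨-trueˡ b refl = refl

∨-trueʳ : ∀ a {b} → b ≡ true → a ∨ b ≡ true
∨-trueʳ false refl = refl
∨-trueʳ true  refl = refl

data PunchInView {n} (u : Fin (suc n)) : Fin (suc n) → Set where
  at-u       : PunchInView u u
  punchIn-of : ∀ i → PunchInView u (punchIn u i)

punchInView : ∀ {n} (u x : Fin (suc n)) → PunchInView u x
punchInView u x with x ≟ u
... | yes refl = at-u
... | no x≢u   = subst (PunchInView u) (punchIn-punchOut (x≢u ∘ sym)) (punchIn-of _)

addVertex : ∀ {n} → Subset n → Fin (suc n) → Subset (suc n)
addVertex S u = insertAt S u true

module _ {n} {u : Fin (suc n)} where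

  ∈-removeVertex⁺ : ∀ {S i} → punchIn u i ∈ S → i ∈ removeVertex S u
  ∈-removeVertex⁺ {S} {i} p = lookup⇒[]= i _ (trans (lookup∘tabulate _ i) ([]=⇒lookup p))

  ∈-removeVertex⁻ : ∀ {S i} → i ∈ removeVertex S u → punchIn u i ∈ S
  ∈-removeVertex⁻ {S} {i} p = lookup⇒[]= _ S (trans (sym (lookup∘tabulate _ i)) ([]=⇒lookup p))

  u∈addVertex : ∀ {S} → u ∈ addVertex S u
  u∈addVertex {S} = lookup⇒[]= u _ (insertAt-lookup S u true)

  ∈-addVertex⁺ : ∀ {S i} → i ∈ S → punchIn u i ∈ addVertex S u
  ∈-addVertex⁺ {S} {i} p = lookup⇒[]= _ _ (trans (insertAt-punchIn S u true i) ([]=⇒lookup p))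

  ∈-addVertex⁻ : ∀ {S i} → punchIn u i ∈ addVertex S u → i ∈ S
  ∈-addVertex⁻ {S} {i} p = lookup⇒[]= i S (trans (sym (insertAt-punchIn S u true i)) ([]=⇒lookup p))

  ⊆-addVertex⇒removeVertex-⊆ : ∀ {T S} → T ⊆ addVertex S u → removeVertex T u ⊆ S
  ⊆-addVertex⇒removeVertex-⊆ T⊆S = ∈-addVertex⁻ ∘ T⊆S ∘ ∈-removeVertex⁻

  removeVertex-⊆⇒⊆-addVertex : ∀ {T S} → removeVertex T u ⊆ S → T ⊆ addVertex S u
  removeVertex-⊆⇒⊆-addVertex {T} T⊆S {x} x∈T with punchInView u x
  ... | at-u         = u∈addVertex
  ... | punchIn-of i = ∈-addVertex⁺ (T⊆S (∈-removeVertex⁺ x∈T))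

  removeVertex-addVertex : ∀ S → removeVertex (addVertex S u) u ≡ S
  removeVertex-addVertex S = trans (tabulate-cong (insertAt-punchIn S u true)) (tabulate∘lookup S)

  addVertex-removeVertex : ∀ {S} → u ∈ S → addVertex (removeVertex S u) u ≡ S
  addVertex-removeVertex {S} u∈S =
    ⊆-antisym addVertex-removeVertex-⊆ (removeVertex-⊆⇒⊆-addVertex (λ p → p))
    where
    addVertex-removeVertex-⊆ : addVertex (removeVertex S u) u ⊆ S
    addVertex-removeVertex-⊆ {x} p with punchInView u x
    ... | at-u         = u∈S
    ... | punchIn-of i = ∈-removeVertex⁻ (∈-addVertex⁻ p)

  addVertex-mono-⊂ : ∀ {S₁ S₂} → S₁ ⊂ S₂ → addVertex S₁ u ⊂ addVertex S₂ u
  addVertex-mono-⊂ (S₁⊆S₂ , i , i∈S₂ , i∉S₁) =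
    removeVertex-⊆⇒⊆-addVertex (S₁⊆S₂ ∘ ∈-addVertex⁻ ∘ ∈-removeVertex⁻) ,
    punchIn u i , ∈-addVertex⁺ i∈S₂ , i∉S₁ ∘ ∈-addVertex⁻

  addVertex-cancel-⊂ : ∀ {S₁ S₂} → addVertex S₁ u ⊂ addVertex S₂ u → S₁ ⊂ S₂
  addVertex-cancel-⊂ {S₁} {S₂} (S₁⊆S₂ , x , x∈S₂ , x∉S₁) with punchInView u x
  ... | at-u         = contradiction u∈addVertex x∉S₁
  ... | punchIn-of i = ∈-addVertex⁻ ∘ S₁⊆S₂ ∘ ∈-addVertex⁺ , i , ∈-addVertex⁻ x∈S₂ , x∉S₁ ∘ ∈-addVertex⁺

module _ {n} {G : Graph n} where

  reach-source : ∀ {S x y} → Reach G S x y → x ∈ S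
  reach-source (here x∈S)     = x∈S
  reach-source (step x∈S _ _) = x∈S

  reach-trans : ∀ {S x y z} → Reach G S x y → Reach G S y z → Reach G S x z
  reach-trans (here _)       r = r
  reach-trans (step x∈S e q) r = step x∈S e (reach-trans q r)

  module _ (G-sym : ∀ x y → G x y ≡ G y x) where

    reach-sym : ∀ {S x y} → Reach G S x y → Reach G S y x
    reach-sym (here x∈S) = here x∈S
    reach-sym (step {x} {y} x∈S e r) =
      reach-trans (reach-sym r) (step (reach-source r) (trans (G-sym y x) e) (here x∈S))

    hub⇒connected : ∀ {S} c → (∀ x → x ∈ S → Reach G S x c) → Connected G S
    hub⇒connected c to-c x y x∈S y∈S = reach-trans (to-c x x∈S) (reach-sym (to-c y y∈S))

adjacent⇒≢ : ∀ {n} (G : Graph n) → (∀ x → G x x ≡ false) → ∀ {u v} → G u v ≡ true → u ≢ v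
adjacent⇒≢ _ irrefl {u} uv refl = contradiction (trans (sym uv) (irrefl u)) λ ()

module Contraction {n} (G : Graph (suc n)) (G-sym : ∀ x y → G x y ≡ G y x)
                   {u v : Fin (suc n)} (u≢v : u ≢ v) (uv : G u v ≡ true) where

  G' : Graph n
  G' = contract G u v

  v' : Fin n
  v' = punchOut u≢v

  punchIn-v' : punchIn u v' ≡ v
  punchIn-v' = punchIn-punchOut u≢v

  -- definitionally the local `added` of contract
  added : Fin (suc n) → Fin (suc n) → Bool
  added x w = ⌊ x ≟ v ⌋ ∧ (G u w ∧ (not ⌊ w ≟ v ⌋ ∧ not (G v w)))

  added⁻ : ∀ x w → added x w ≡ true → x ≡ v × G u w ≡ true
  added⁻ x w p with x ≟ v | G u w
  ... | yes x≡v | true = x≡v , refl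

  added⁺ : ∀ w → G u w ≡ true → w ≢ v → G v w ≡ false → added v w ≡ true
  added⁺ w uw w≢v vw with v ≟ v | w ≟ v
  ... | no v≢v | _       = contradiction refl v≢v
  ... | yes _  | yes w≡v = contradiction w≡v w≢v
  ... | yes _  | no _    rewrite uw | vw = refl

  contract-sym : ∀ i j → G' i j ≡ G' j i
  contract-sym i j = cong₂ _∨_ (G-sym a b) (∨-comm (added a b) (added b a))
    where
    a = punchIn u i
    b = punchIn u j

  contract-⊇ : ∀ {i j} → G (punchIn u i) (punchIn u j) ≡ true → G' i j ≡ true
  contract-⊇ {i} {j} = ∨-trueˡ (added (punchIn u i) (punchIn u j) ∨ added (punchIn u j) (punchIn u i))

  contract-edge⁻ : ∀ {i j} → G' i j ≡ true →
    G (punchIn u i) (punchIn u j) ≡ true ⊎ (G (punchIn u i) u ≡ true × G u (punchIn u j) ≡ true)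
  contract-edge⁻ {i} {j} e with ∨-true⁻ (G (punchIn u i) (punchIn u j)) e
  ... | inj₁ ab = inj₁ ab
  ... | inj₂ e′ with ∨-true⁻ (added (punchIn u i) (punchIn u j)) e′
  ...   | inj₁ p with a≡v , ub ← added⁻ (punchIn u i) (punchIn u j) p =
    inj₂ (trans (cong (λ x → G x u) a≡v) (trans (G-sym v u) uv) , ub)
  ...   | inj₂ p with b≡v , ua ← added⁻ (punchIn u j) (punchIn u i) p =
    inj₂ (trans (G-sym _ u) ua , trans (cong (G u) b≡v) uv)

  contract-neighbour : ∀ {i} → G u (punchIn u i) ≡ true → i ≢ v' → G' i v' ≡ true
  contract-neighbour {i} ua i≢v' =
    subst (λ w → G a w ∨ (added a w ∨ added w a) ≡ true) (sym punchIn-v') a-v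
    where
    a = punchIn u i
    a≢v : a ≢ v
    a≢v a≡v = i≢v' (punchIn-injective u i v' (trans a≡v (sym punchIn-v')))
    a-v : G a v ∨ (added a v ∨ added v a) ≡ true
    a-v with G a v in av
    ... | true  = refl
    ... | false = ∨-trueʳ (added a v) (added⁺ a ua a≢v (trans (G-sym v a) av))

  v∈addVertex : ∀ {S'} → v' ∈ S' → v ∈ addVertex S' u
  v∈addVertex {S'} v'∈S' = subst (_∈ addVertex S' u) punchIn-v' (∈-addVertex⁺ v'∈S')

  lift-walk : ∀ {S' i j} → Reach G' S' i j → Reach G (addVertex S' u) (punchIn u i) (punchIn u j)
  lift-walk (here i∈S')         = here (∈-addVertex⁺ i∈S')
  lift-walk (step i∈S' e r) with contract-edge⁻ e
  ... | inj₁ ab        = step (∈-addVertex⁺ i∈S') ab (lift-walk r)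
  ... | inj₂ (au , ub) = step (∈-addVertex⁺ i∈S') au (step u∈addVertex ub (lift-walk r))

  -- A walk that reaches u is cut short there: the vertex before u is adjacent to v' in G'.
  contract-walk : ∀ {S' x i} → v' ∈ S' → punchIn u i ≡ x → Reach G (addVertex S' u) x v →
                  Reach G' S' i v'
  contract-walk {S'} {i = i} v'∈S' a≡v (here _) =
    subst (λ k → Reach G' S' k v') (sym (punchIn-injective u i v' (trans a≡v (sym punchIn-v'))))
          (here v'∈S')
  contract-walk {i = i} v'∈S' refl (step {y = y} a∈S ay r) with punchInView u y
  ... | punchIn-of j = step (∈-addVertex⁻ a∈S) (contract-⊇ ay) (contract-walk v'∈S' refl r)
  ... | at-u with i ≟ v'
  ...   | yes refl  = here v'∈S'
  ...   | no i≢v'   =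
    step (∈-addVertex⁻ a∈S) (contract-neighbour (trans (G-sym u _) ay) i≢v') (here v'∈S')

  lift-connected : ∀ {S'} → v' ∈ S' → Connected G' S' → Connected G (addVertex S' u)
  lift-connected {S'} v'∈S' C = hub⇒connected G-sym v to-v
    where
    to-v : ∀ x → x ∈ addVertex S' u → Reach G (addVertex S' u) x v
    to-v x x∈S with punchInView u x
    ... | at-u         = step x∈S uv (here (v∈addVertex v'∈S'))
    ... | punchIn-of i =
      subst (Reach G _ (punchIn u i)) punchIn-v' (lift-walk (C i v' (∈-addVertex⁻ x∈S) v'∈S'))

  contract-connected : ∀ {S'} → v' ∈ S' → Connected G (addVertex S' u) → Connected G' S'
  contract-connected v'∈S' C = hub⇒connected contract-sym v' λ i i∈S' →
    contract-walk v'∈S' refl (C _ v (∈-addVertex⁺ i∈S') (v∈addVertex v'∈S'))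

  module _ {T : Subset (suc n)} (u∈T : u ∈ T) (v∈T : v ∈ T) where

    T' : Subset n
    T' = removeVertex T u

    v'∈T' : v' ∈ T'
    v'∈T' = ∈-removeVertex⁺ (subst (_∈ T) (sym punchIn-v') v∈T)

    contract-tConnecting : ∀ {S'} → TConnecting G T (addVertex S' u) → TConnecting G' T' S'
    contract-tConnecting (T⊆S , C) = T'⊆S' , contract-connected (T'⊆S' v'∈T') C
      where T'⊆S' = ⊆-addVertex⇒removeVertex-⊆ T⊆S

    lift-tConnecting : ∀ {S'} → TConnecting G' T' S' → TConnecting G T (addVertex S' u)
    lift-tConnecting (T'⊆S' , C) = removeVertex-⊆⇒⊆-addVertex T'⊆S' , lift-connected (T'⊆S' v'∈T') C

    contract-minTConnecting : ∀ {S'} → MinTConnecting G T (addVertex S' u) → MinTConnecting G' T' S'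
    contract-minTConnecting (conn , minimal) = contract-tConnecting conn , λ S'' S''⊂S' →
      minimal (addVertex S'' u) (addVertex-mono-⊂ S''⊂S') ∘ lift-tConnecting

    lift-minTConnecting : ∀ {S'} → MinTConnecting G' T' S' → MinTConnecting G T (addVertex S' u)
    lift-minTConnecting {S'} (conn , minimal) = lift-tConnecting conn , smaller-not-tConnecting
      where
      smaller-not-tConnecting : ∀ S → S ⊂ addVertex S' u → ¬ TConnecting G T S
      smaller-not-tConnecting S S⊂ conn-S =
        minimal (removeVertex S u) (addVertex-cancel-⊂ (subst (_⊂ addVertex S' u) (sym S≡) S⊂))
          (contract-tConnecting (subst (TConnecting G T) (sym S≡) conn-S))
        where S≡ = addVertex-removeVertex (proj₁ conn-S u∈T)

lemma3 : ∀ (n : ℕ) (G : Graph (suc n)) → IsSimple G →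
    ∀ (T : Subset (suc n)) (u v : Fin (suc n)) → u ∈ T → v ∈ T → G u v ≡ true →
    Σ (Subset (suc n) → Subset n) λ f →
      (∀ S → MinTConnecting G T S → MinTConnecting (contract G u v) (removeVertex T u) (f S))
      × (∀ S₁ S₂ → MinTConnecting G T S₁ → MinTConnecting G T S₂ → f S₁ ≡ f S₂ → S₁ ≡ S₂)
      × (∀ S' → MinTConnecting (contract G u v) (removeVertex T u) S' →
           ∃ λ S → MinTConnecting G T S × f S ≡ S')
lemma3 n G (G-sym , G-irrefl) T u v u∈T v∈T uv =
  (λ S → removeVertex S u) , preserves , injective , surjective
  where
  open Contraction G G-sym (adjacent⇒≢ G G-irrefl uv) uv

  addVertex-removeVertex-min : ∀ {S} → MinTConnecting G T S → addVertex (removeVertex S u) u ≡ S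
  addVertex-removeVertex-min ((T⊆S , _) , _) = addVertex-removeVertex (T⊆S u∈T)

  preserves : ∀ S → MinTConnecting G T S → MinTConnecting G' (removeVertex T u) (removeVertex S u)
  preserves S min-S =
    contract-minTConnecting u∈T v∈T
      (subst (MinTConnecting G T) (sym (addVertex-removeVertex-min min-S)) min-S)

  injective : ∀ S₁ S₂ → MinTConnecting G T S₁ → MinTConnecting G T S₂ →
              removeVertex S₁ u ≡ removeVertex S₂ u → S₁ ≡ S₂
  injective S₁ S₂ min-S₁ min-S₂ eq = begin
    S₁                              ≡⟨ sym (addVertex-removeVertex-min min-S₁) ⟩
    addVertex (removeVertex S₁ u) u ≡⟨ cong (λ S' → addVertex S' u) eq ⟩
    addVertex (removeVertex S₂ u) u ≡⟨ addVertex-removeVertex-min min-S₂ ⟩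
    S₂                              ∎
    where open ≡-Reasoning

  surjective : ∀ S' → MinTConnecting G' (removeVertex T u) S' →
               ∃ λ S → MinTConnecting G T S × removeVertex S u ≡ S'
  surjective S' min-S' =
    addVertex S' u , lift-minTConnecting u∈T v∈T min-S' , removeVertex-addVertex {u = u} S'
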